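{- Let $P$ be a cubical $d$-polytope with $d\ge 4$, and let $X$ be a set of $d+1$ vertices of $P$, all contained in a facet $F$ of $P$. Let $k=\lfloor (d+1)/2\rfloor$, and arbitrarily label and pair $2k$ of the vertices of $X$ to obtain $Y=\{\{s_1,t_1\},\dots,\{s_k,t_k\}\}$. Then for at least $k-1$ of the pairs $\{s_i,t_i\}$ there is an $X$-valid path from $s_i$ to $t_i$ in the graph of $F$.
   Context: A cubical polytope is one all of whose facets are combinatorially equivalent to cubes. A path is $X$-valid if none of its inner vertices belongs to $X$. -}

module Defs where

open import Data.Nat using (ℕ; zero; suc; _+_)
open import Data.Bool using (Bool; _≟_)
open import Data.Vec using (Vec; []; _∷_)
open import Data.List using (List; []; _∷_; _++_; [_])
open import Data.List.Relation.Unary.All using (All)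
open import Data.List.Relation.Unary.Linked using (Linked)
open import Data.List.Relation.Unary.Unique.Propositional using (Unique)
open import Data.List.Membership.Propositional using (_∉_)
open import Data.Product using (Σ; _×_)
open import Relation.Nullary using (yes; no)
open import Relation.Binary.PropositionalEquality using (_≡_)

CubeVertex : ℕ → Set
CubeVertex n = Vec Bool n

hamming : ∀ {n} → CubeVertex n → CubeVertex n → ℕ
hamming [] [] = 0
hamming (a ∷ u) (b ∷ v) with a ≟ b
... | yes _ = hamming u v
... | no _  = suc (hamming u v)

CubeAdj : ∀ {n} → CubeVertex n → CubeVertex n → Set
CubeAdj u v = hamming u v ≡ 1

XValidPath : ∀ {n} → List (CubeVertex n) → CubeVertex n → CubeVertex n → Set
XValidPath {n} X s t =
  Σ (List (CubeVertex n)) λ inner →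
    Linked CubeAdj (s ∷ inner ++ [ t ]) ×
    Unique (s ∷ inner ++ [ t ]) ×
    All (_∉ X) inner

module Submission where

-- The facet F is a combinatorial n-cube Qₙ with n = d - 1 ≥ 3, and |X| = n + 2.
-- Call a vertex of X isolated if all its neighbours lie in X.  Two distinct
-- isolated vertices would force n + 3 distinct vertices into X (one of them,
-- its n neighbours, and two further vertices far from it), so at most one
-- pair has an isolated end.  For every other pair {s, t} we delete s and t
-- from X, leaving a set A of at most n vertices, and join s to t by a walk in
-- Qₙ avoiding A; cutting the loops out of that walk gives an X-valid path.

open import Defs
open import Data.Bool using (Bool; true; false; not)
import Data.Bool as Bool
open import Data.Bool.Properties using (¬-not; not-¬)
open import Data.Empty using (⊥-elim)
open import Data.Fin using (Fin; zero; suc)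
import Data.Fin.Properties as Fin
open import Data.Fin.Subset using (Subset; ∣_∣; ⊤; ⁅_⁆; ∁) renaming (_∈_ to _∈ₛ_)
open import Data.Fin.Subset.Properties using (∣⊤∣≡n; ∣∁p∣≡n∸∣p∣; ∣⁅x⁆∣≡1; x∈⁅x⁆; x∈∁p⇒x∉p)
open import Data.List using (List; []; _∷_; length; _++_; _∷ʳ_; map; tabulate; filter; allFin; initLast; _∷ʳ′_)
open import Data.List.Properties using (length-++; length-tabulate; map-tabulate; filter-notAll)
open import Data.List.Membership.Propositional using (_∈_; _∉_)
open import Data.List.Membership.Propositional.Properties using (∈-filter⁺; ∈-filter⁻; ∈-++⁺ˡ; ∈-++⁺ʳ; ∈-map⁺; ∈-allFin; ∈-tabulate⁻)
import Data.List.Membership.DecPropositional as DecMembership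
open import Data.List.Relation.Unary.All using (All; []; _∷_)
import Data.List.Relation.Unary.All as All
import Data.List.Relation.Unary.All.Properties as All
open import Data.List.Relation.Unary.Any using (here; there)
import Data.List.Relation.Unary.Any as Any
open import Data.List.Relation.Unary.AllPairs using (AllPairs; []; _∷_)
open import Data.List.Relation.Unary.Linked using (Linked; [-]; _∷_)
open import Data.List.Relation.Unary.Unique.Propositional using (Unique)
import Data.List.Relation.Unary.Unique.Propositional.Properties as Unique
open import Data.Nat using (ℕ; zero; suc; _+_; _*_; _≤_; _<_; _∸_; _^_; _/_; z≤n; s≤s)
open import Data.Nat.Properties
open import Data.Product using (Σ; _×_; _,_; proj₁; proj₂)
open import Data.Sum using (_⊎_; inj₁; inj₂)
open import Data.Vec using ([]; _∷_)
import Data.Vec.Properties as Vec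
open import Function using (_∘_)
open import Relation.Binary.Definitions using (DecidableEquality)
open import Relation.Binary.PropositionalEquality
open import Relation.Nullary using (¬_; Dec; yes; no; ¬?)
open import Relation.Nullary.Decidable using (_×-dec_; decidable-stable)

at-most-one : ∀ {a} {A : Set a} {x y : A} (L : List A) → length L ≤ 1 → x ∈ L → y ∈ L → x ≡ y
at-most-one (_ ∷ []) _ (here refl) (here refl) = refl
at-most-one (_ ∷ _ ∷ _) (s≤s ()) _ _

length≡0⇒∉ : ∀ {a} {A : Set a} {x : A} (L : List A) → length L ≡ 0 → x ∉ L
length≡0⇒∉ [] _ ()

unique-++⁻ˡ : ∀ {a} {A : Set a} (P Q : List A) → Unique (P ++ Q) → Unique P
unique-++⁻ˡ [] Q _ = []
unique-++⁻ˡ (x ∷ P) Q (x∉ ∷ u) = All.++⁻ˡ P x∉ ∷ unique-++⁻ˡ P Q u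

unique-++⁻ʳ : ∀ {a} {A : Set a} (P Q : List A) → Unique (P ++ Q) → Unique Q
unique-++⁻ʳ [] Q u = u
unique-++⁻ʳ (x ∷ P) Q (_ ∷ u) = unique-++⁻ʳ P Q u

unique-++-disjoint : ∀ {a} {A : Set a} (P Q : List A) → Unique (P ++ Q) →
  ∀ {x y} → x ∈ P → y ∈ Q → x ≢ y
unique-++-disjoint (x ∷ P) Q (x∉ ∷ _) (here refl) y∈Q = All.lookup (All.++⁻ʳ P x∉) y∈Q
unique-++-disjoint (_ ∷ P) Q (_ ∷ u) (there x∈P) y∈Q = unique-++-disjoint P Q u x∈P y∈Q

unique-tabulate⁻ : ∀ {a} {A : Set a} {K} (f : Fin K → A) → Unique (tabulate f) →
  ∀ {i j} → i ≢ j → f i ≢ f j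
unique-tabulate⁻ f _ {zero} {zero} i≢j = ⊥-elim (i≢j refl)
unique-tabulate⁻ f (f₀∉ ∷ _) {zero} {suc j} _ = All.tabulate⁻ f₀∉ j
unique-tabulate⁻ f (f₀∉ ∷ _) {suc i} {zero} _ = All.tabulate⁻ f₀∉ i ∘ sym
unique-tabulate⁻ f (_ ∷ u) {suc i} {suc j} i≢j = unique-tabulate⁻ (f ∘ suc) u (i≢j ∘ cong suc)

AllPairs-∷ʳ⁻ : ∀ {a r} {A : Set a} {R : A → A → Set r} {t} (xs : List A) →
  AllPairs R (xs ∷ʳ t) → All (λ y → R y t) xs
AllPairs-∷ʳ⁻ [] _ = []
AllPairs-∷ʳ⁻ (x ∷ xs) (Rx ∷ rest) = All.lookup (All.++⁻ʳ xs Rx) (here refl) ∷ AllPairs-∷ʳ⁻ xs rest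

module Removal {a} {A : Set a} (_≟_ : DecidableEquality A) where

  remove : A → List A → List A
  remove x = filter (λ y → ¬? (y ≟ x))

  ∈-remove⁺ : ∀ {x y} (L : List A) → y ∈ L → y ≢ x → y ∈ remove x L
  ∈-remove⁺ {x} L = ∈-filter⁺ (λ y → ¬? (y ≟ x))

  ∈-remove⁻ : ∀ {x y} (L : List A) → y ∈ remove x L → y ∈ L × y ≢ x
  ∈-remove⁻ {x} L = ∈-filter⁻ (λ y → ¬? (y ≟ x))

  remove-shorter : ∀ {x} (L : List A) → x ∈ L → length (remove x L) < length L
  remove-shorter {x} L x∈L = filter-notAll (λ y → ¬? (y ≟ x)) L (Any.map (λ x≡y y≢x → y≢x (sym x≡y)) x∈L)

  unique-⊆-length : ∀ (K L : List A) → Unique K → All (_∈ L) K → length K ≤ length L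
  unique-⊆-length [] L _ _ = z≤n
  unique-⊆-length (x ∷ K) L (x∉K ∷ uK) (x∈L ∷ K⊆L) =
    ≤-trans (s≤s (unique-⊆-length K (remove x L) uK K⊆L-x)) (remove-shorter L x∈L)
    where
    K⊆L-x : All (_∈ remove x L) K
    K⊆L-x = All.zipWith (λ (x≢y , y∈L) → ∈-remove⁺ L y∈L (x≢y ∘ sym)) (x∉K , K⊆L)

_≟ᵥ_ : ∀ {n} → DecidableEquality (CubeVertex n)
_≟ᵥ_ = Vec.≡-dec Bool._≟_

_∈ᵥ?_ : ∀ {n} (v : CubeVertex n) (A : List (CubeVertex n)) → Dec (v ∈ A)
v ∈ᵥ? A = DecMembership._∈?_ _≟ᵥ_ v A

open module VertexRemoval {n} = Removal (_≟ᵥ_ {n})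

hamming-self : ∀ {n} (u : CubeVertex n) → hamming u u ≡ 0
hamming-self [] = refl
hamming-self (true ∷ u) = hamming-self u
hamming-self (false ∷ u) = hamming-self u

hamming-≡-head : ∀ {n} (b c : Bool) (u v : CubeVertex n) → b ≡ c → hamming (b ∷ u) (c ∷ v) ≡ hamming u v
hamming-≡-head b c u v b≡c with b Bool.≟ c
... | yes _ = refl
... | no b≢c = ⊥-elim (b≢c b≡c)

hamming-≢-head : ∀ {n} (b c : Bool) (u v : CubeVertex n) → b ≢ c → hamming (b ∷ u) (c ∷ v) ≡ suc (hamming u v)
hamming-≢-head b c u v b≢c with b Bool.≟ c
... | yes b≡c = ⊥-elim (b≢c b≡c)
... | no _ = refl

hamming-sym : ∀ {n} (u v : CubeVertex n) → hamming u v ≡ hamming v u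
hamming-sym [] [] = refl
hamming-sym (true ∷ u) (true ∷ v) = hamming-sym u v
hamming-sym (true ∷ u) (false ∷ v) = cong suc (hamming-sym u v)
hamming-sym (false ∷ u) (true ∷ v) = cong suc (hamming-sym u v)
hamming-sym (false ∷ u) (false ∷ v) = hamming-sym u v

hamming≡0⇒≡ : ∀ {n} (u v : CubeVertex n) → hamming u v ≡ 0 → u ≡ v
hamming≡0⇒≡ [] [] _ = refl
hamming≡0⇒≡ (true ∷ u) (true ∷ v) h = cong (true ∷_) (hamming≡0⇒≡ u v h)
hamming≡0⇒≡ (false ∷ u) (false ∷ v) h = cong (false ∷_) (hamming≡0⇒≡ u v h)

adj-sym : ∀ {n} {u v : CubeVertex n} → CubeAdj u v → CubeAdj v u
adj-sym {u = u} {v} = trans (hamming-sym v u)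

adj-irrefl : ∀ {n} (u : CubeVertex n) → ¬ CubeAdj u u
adj-irrefl u adj with () ← trans (sym (hamming-self u)) adj

adj-∷ : ∀ {n} b {u v : CubeVertex n} → CubeAdj u v → CubeAdj (b ∷ u) (b ∷ v)
adj-∷ b {u} {v} = trans (hamming-≡-head b b u v refl)

adj-across : ∀ {n} {b c : Bool} (u : CubeVertex n) → b ≢ c → CubeAdj (b ∷ u) (c ∷ u)
adj-across {b = b} {c} u b≢c = trans (hamming-≢-head b c u u b≢c) (cong suc (hamming-self u))

flipAt : ∀ {n} → Fin n → CubeVertex n → CubeVertex n
flipAt zero (b ∷ v) = not b ∷ v
flipAt (suc i) (b ∷ v) = b ∷ flipAt i v

adj-flip : ∀ {n} (i : Fin n) (a : CubeVertex n) → CubeAdj a (flipAt i a)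
adj-flip zero (b ∷ v) = adj-across v (not-¬ {b} refl)
adj-flip (suc i) (b ∷ v) = adj-∷ b (adj-flip i v)

flip-injective : ∀ {n} (i j : Fin n) (a : CubeVertex n) → flipAt i a ≡ flipAt j a → i ≡ j
flip-injective zero zero _ _ = refl
flip-injective zero (suc j) (b ∷ v) e = ⊥-elim (not-¬ refl (sym (Vec.∷-injectiveˡ e)))
flip-injective (suc i) zero (b ∷ v) e = ⊥-elim (not-¬ refl (Vec.∷-injectiveˡ e))
flip-injective (suc i) (suc j) (b ∷ v) e = cong suc (flip-injective i j v (Vec.∷-injectiveʳ e))

adj⇒flip : ∀ {n} (a b : CubeVertex n) → CubeAdj a b → Σ (Fin n) λ i → b ≡ flipAt i a
adj⇒flip [] [] ()
adj⇒flip (true ∷ u) (true ∷ v) h = let (i , e) = adj⇒flip u v h in suc i , cong (true ∷_) e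
adj⇒flip (false ∷ u) (false ∷ v) h = let (i , e) = adj⇒flip u v h in suc i , cong (false ∷_) e
adj⇒flip (true ∷ u) (false ∷ v) h = zero , cong (false ∷_) (sym (hamming≡0⇒≡ u v (suc-injective h)))
adj⇒flip (false ∷ u) (true ∷ v) h = zero , cong (true ∷_) (sym (hamming≡0⇒≡ u v (suc-injective h)))

hamming-flip-flip : ∀ {n} (i j : Fin n) (a : CubeVertex n) → i ≢ j → hamming a (flipAt i (flipAt j a)) ≡ 2
hamming-flip-flip zero zero _ i≢j = ⊥-elim (i≢j refl)
hamming-flip-flip zero (suc j) (b ∷ v) _ = trans (hamming-≢-head b (not b) v _ (not-¬ refl)) (cong suc (adj-flip j v))
hamming-flip-flip (suc i) zero (b ∷ v) _ = trans (hamming-≢-head b (not b) v _ (not-¬ refl)) (cong suc (adj-flip i v))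
hamming-flip-flip (suc i) (suc j) (b ∷ v) i≢j =
  trans (hamming-≡-head b b v _ refl) (hamming-flip-flip i j v (i≢j ∘ cong suc))

away-flip : ∀ {n} (a b : CubeVertex n) → hamming a b < n →
  Σ (Fin n) λ i → hamming a (flipAt i b) ≡ suc (hamming a b)
away-flip (true ∷ u) (true ∷ v) _ = zero , refl
away-flip (false ∷ u) (false ∷ v) _ = zero , refl
away-flip (true ∷ u) (false ∷ v) (s≤s h<n) = let (i , e) = away-flip u v h<n in suc i , cong suc e
away-flip (false ∷ u) (true ∷ v) (s≤s h<n) = let (i , e) = away-flip u v h<n in suc i , cong suc e

far-flip : ∀ {n} → 2 ≤ n → (a b : CubeVertex (suc n)) → 2 ≤ hamming a b →
  Σ (Fin (suc n)) λ i → 2 ≤ hamming a (flipAt i b)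
far-flip 2≤n (x ∷ a) (y ∷ b) far with x Bool.≟ y
... | yes refl = zero , ≤-trans (m≤n⇒m≤1+n far) (≤-reflexive (sym (hamming-≢-head x (not x) a b (not-¬ refl))))
... | no x≢y with 2 ≤? hamming a b
...   | yes far′ = zero , ≤-trans far′ (≤-reflexive (sym (hamming-≡-head x (not y) a b (¬-not x≢y))))
...   | no near with away-flip a b (≤-trans (≰⇒> near) 2≤n)
...     | i , e = suc i , ≤-trans (s≤s (s≤s z≤n))
                                      (≤-reflexive (sym (trans (hamming-≢-head x y a _ x≢y) (cong suc e))))

-- Walks avoiding a set of vertices

data Walk {n} (A : List (CubeVertex n)) : CubeVertex n → CubeVertex n → Set where
  stay : ∀ {u} → u ∉ A → Walk A u u
  step : ∀ {u v w} → u ∉ A → CubeAdj u v → Walk A v w → Walk A u w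

walk-start : ∀ {n} {A : List (CubeVertex n)} {u w} → Walk A u w → u ∉ A
walk-start (stay u∉) = u∉
walk-start (step u∉ _ _) = u∉

walk-end : ∀ {n} {A : List (CubeVertex n)} {u w} → Walk A u w → w ∉ A
walk-end (stay w∉) = w∉
walk-end (step _ _ rest) = walk-end rest

_++ʷ_ : ∀ {n} {A : List (CubeVertex n)} {u v w} → Walk A u v → Walk A v w → Walk A u w
stay _ ++ʷ q = q
step u∉ adj p ++ʷ q = step u∉ adj (p ++ʷ q)

reverseʷ : ∀ {n} {A : List (CubeVertex n)} {u w} → Walk A u w → Walk A w u
reverseʷ (stay u∉) = stay u∉
reverseʷ (step {u} {v} u∉ adj rest) = reverseʷ rest ++ʷ step (walk-start rest) (adj-sym {u = u} {v} adj) (stay u∉)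

Connected : ∀ {n} → List (CubeVertex n) → Set
Connected A = ∀ {x y} → x ∉ A → y ∉ A → Walk A x y

slice : ∀ {m} → Bool → List (CubeVertex (suc m)) → List (CubeVertex m)
slice b [] = []
slice b ((c ∷ v) ∷ A) with c Bool.≟ b
... | yes _ = v ∷ slice b A
... | no _ = slice b A

slice-∈⁺ : ∀ {m} b {v : CubeVertex m} (A : List (CubeVertex (suc m))) → (b ∷ v) ∈ A → v ∈ slice b A
slice-∈⁺ b ((c ∷ x) ∷ A) (here e) with c Bool.≟ b
... | yes _ = here (Vec.∷-injectiveʳ e)
... | no c≢b = ⊥-elim (c≢b (sym (Vec.∷-injectiveˡ e)))
slice-∈⁺ b ((c ∷ x) ∷ A) (there v∈) with c Bool.≟ b
... | yes _ = there (slice-∈⁺ b A v∈)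
... | no _ = slice-∈⁺ b A v∈

slice-∈⁻ : ∀ {m} b {v : CubeVertex m} (A : List (CubeVertex (suc m))) → v ∈ slice b A → (b ∷ v) ∈ A
slice-∈⁻ b ((c ∷ x) ∷ A) v∈ with c Bool.≟ b
slice-∈⁻ b ((c ∷ x) ∷ A) (here refl) | yes refl = here refl
slice-∈⁻ b ((c ∷ x) ∷ A) (there v∈) | yes _ = there (slice-∈⁻ b A v∈)
... | no _ = there (slice-∈⁻ b A v∈)

slice-length : ∀ {m} b (A : List (CubeVertex (suc m))) →
  length (slice b A) + length (slice (not b) A) ≡ length A
slice-length b [] = refl
slice-length true ((true ∷ v) ∷ A) = cong suc (slice-length true A)
slice-length true ((false ∷ v) ∷ A) = trans (+-suc _ _) (cong suc (slice-length true A))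
slice-length false ((false ∷ v) ∷ A) = cong suc (slice-length false A)
slice-length false ((true ∷ v) ∷ A) = trans (+-suc _ _) (cong suc (slice-length false A))

slice-short : ∀ {m k r} b (A : List (CubeVertex (suc m))) →
  length A < k + r → k ≤ length (slice (not b) A) → length (slice b A) < r
slice-short {k = k} {r} b A short long = +-cancelˡ-< k _ r (begin-strict
  k + length (slice b A)                        ≤⟨ +-monoˡ-≤ _ long ⟩
  length (slice (not b) A) + length (slice b A) ≡⟨ +-comm _ (length (slice b A)) ⟩
  length (slice b A) + length (slice (not b) A) ≡⟨ slice-length b A ⟩
  length A                                      <⟨ short ⟩
  k + r                                         ∎)
  where open ≤-Reasoning

lift-walk : ∀ {m} (A : List (CubeVertex (suc m))) b {x y} → Walk (slice b A) x y → Walk A (b ∷ x) (b ∷ y)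
lift-walk A b (stay x∉) = stay (x∉ ∘ slice-∈⁺ b A)
lift-walk A b (step x∉ adj rest) = step (x∉ ∘ slice-∈⁺ b A) (adj-∷ b adj) (lift-walk A b rest)

EntersFacet : ∀ {m} → List (CubeVertex (suc m)) → Bool → CubeVertex (suc m) → Set
EntersFacet {m} A b u = Σ (CubeVertex m) λ x → Walk A u (b ∷ x)

connect-via-facet : ∀ {m} (A : List (CubeVertex (suc m))) b → Connected (slice b A) →
  ∀ {u w} → EntersFacet A b u → EntersFacet A b w → Walk A u w
connect-via-facet A b facet (x , to-x) (y , to-y) =
  to-x ++ʷ (lift-walk A b (facet (walk-end to-x ∘ slice-∈⁻ b A) (walk-end to-y ∘ slice-∈⁻ b A))
        ++ʷ reverseʷ to-y)

connect-via-bridge : ∀ {m} (A : List (CubeVertex (suc m))) → (∀ b → Connected (slice b A)) →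
  ∀ {v} → (∀ b → v ∉ slice b A) → Connected A
connect-via-bridge A facet {v} v∉ {c ∷ u} {d ∷ w} u∉ w∉ with c Bool.≟ d
... | yes refl = lift-walk A c (facet c (u∉ ∘ slice-∈⁻ c A) (w∉ ∘ slice-∈⁻ c A))
... | no c≢d = lift-walk A c (facet c (u∉ ∘ slice-∈⁻ c A) (v∉ c))
           ++ʷ step (v∉ c ∘ slice-∈⁺ c A) (adj-across v c≢d)
                 (lift-walk A d (facet d (v∉ d) (w∉ ∘ slice-∈⁻ d A)))

<-double : ∀ {x y} → y < x → suc y < 2 * x
<-double {x} {y} y<x =
  subst (_≤ 2 * x) (+-comm (suc y) 1)
        (+-mono-≤ y<x (≤-trans (≤-trans (s≤s z≤n) y<x) (≤-reflexive (sym (+-identityʳ x)))))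

n<2^n : ∀ n → n < 2 ^ n
n<2^n zero = s≤s z≤n
n<2^n (suc n) = <-double (n<2^n n)

1+n<2^n : ∀ {n} → 2 ≤ n → suc n < 2 ^ n
1+n<2^n {1} (s≤s ())
1+n<2^n {2} _ = s≤s (s≤s (s≤s (s≤s z≤n)))
1+n<2^n {suc (suc (suc n))} _ = <-double (1+n<2^n {suc (suc n)} (s≤s (s≤s z≤n)))

missing-vertex : ∀ m (L : List (CubeVertex m)) → length L < 2 ^ m → Σ (CubeVertex m) (_∉ L)
missing-vertex zero [] _ = [] , λ ()
missing-vertex zero (_ ∷ _) (s≤s ())
missing-vertex (suc m) L short with length (slice false L) <? 2 ^ m
... | yes short₀ = let (v , v∉) = missing-vertex m (slice false L) short₀ in false ∷ v , v∉ ∘ slice-∈⁺ false L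
... | no long₀ = let (v , v∉) = missing-vertex m (slice true L) short₁ in true ∷ v , v∉ ∘ slice-∈⁺ true L
  where
  short₁ : length (slice true L) < 2 ^ m
  short₁ = subst (length (slice true L) <_) (+-identityʳ (2 ^ m)) (slice-short true L short (≮⇒≥ long₀))

common-free-vertex : ∀ {m} (A : List (CubeVertex (suc m))) → length A < 2 ^ m →
  Σ (CubeVertex m) λ v → ∀ b → v ∉ slice b A
common-free-vertex {m} A short with missing-vertex m (slice false A ++ slice true A) short′
  where
  short′ : length (slice false A ++ slice true A) < 2 ^ m
  short′ = subst (_< 2 ^ m) (sym (trans (length-++ (slice false A)) (slice-length false A))) short
... | v , v∉ = v , λ { false → v∉ ∘ ∈-++⁺ˡ ; true → v∉ ∘ ∈-++⁺ʳ _ }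

-- Connectivity of the cube after deleting few vertices

FreeNeighbour : ∀ {n} → List (CubeVertex n) → CubeVertex n → Set
FreeNeighbour {n} A u = Σ (CubeVertex n) λ y → CubeAdj u y × y ∉ A

enter-empty-facet : ∀ {m} (A : List (CubeVertex (suc m))) b → length (slice b A) ≡ 0 →
  ∀ {u} → u ∉ A → EntersFacet A b u
enter-empty-facet A b empty {c ∷ u} u∉ with c Bool.≟ b
... | yes refl = u , stay u∉
... | no c≢b = u , step u∉ (adj-across u c≢b) (stay (length≡0⇒∉ (slice b A) empty ∘ slice-∈⁺ b A))

-- If the facet {x₀ = b} contains at most one vertex of A, every u ∉ A with a
-- free neighbour enters it in at most two steps: directly, or via a free
-- neighbour inside u's own facet.
enter-sparse-facet : ∀ {m} (A : List (CubeVertex (suc m))) b → length (slice b A) ≤ 1 →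
  ∀ {u} → u ∉ A → FreeNeighbour A u → EntersFacet A b u
enter-sparse-facet A b sparse {c ∷ u} u∉ free with c Bool.≟ b
... | yes refl = u , stay u∉
... | no c≢b with (b ∷ u) ∈ᵥ? A
...   | no b∷u∉ = u , step u∉ (adj-across u c≢b) (stay b∷u∉)
...   | yes b∷u∈ = detour free
  where
  detour : FreeNeighbour A (c ∷ u) → EntersFacet A b (c ∷ u)
  detour (y , adj , y∉) with adj⇒flip (c ∷ u) y adj
  ... | zero , refl = ⊥-elim (y∉ (subst (λ d → (d ∷ u) ∈ A) (¬-not (c≢b ∘ sym)) b∷u∈))
  ... | suc i , refl = flipAt i u , step u∉ adj (step y∉ (adj-across (flipAt i u) c≢b) (stay b∷y∉))
    where
    -- the only vertex of A in facet b is b ∷ u, and flipAt i u ≠ u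
    b∷y∉ : (b ∷ flipAt i u) ∉ A
    b∷y∉ b∷y∈ = adj-irrefl u (subst (CubeAdj u)
      (at-most-one (slice b A) sparse (slice-∈⁺ b A b∷y∈) (slice-∈⁺ b A b∷u∈)) (adj-flip i u))

cube-connected : ∀ m (A : List (CubeVertex m)) → length A < m ⊎ length A ≡ 0 → Connected A
cube-connected zero A _ {[]} {[]} u∉ _ = stay u∉
cube-connected (suc m) A few {u} {w} u∉ w∉ with length (slice true A) ≟ 0 | length (slice false A) ≟ 0
... | yes empty | _ = connect-via-facet A true (cube-connected m _ (inj₂ empty))
                        (enter-empty-facet A true empty u∉) (enter-empty-facet A true empty w∉)
... | no _ | yes empty = connect-via-facet A false (cube-connected m _ (inj₂ empty))
                           (enter-empty-facet A false empty u∉) (enter-empty-facet A false empty w∉)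
... | no nonempty₁ | no nonempty₀ = connect-via-bridge A facet (proj₂ free) u∉ w∉
  where
  |A|≤m : length A < 1 + m
  |A|≤m = bound few
    where
    bound : length A < 1 + m ⊎ length A ≡ 0 → length A < 1 + m
    bound (inj₁ short) = short
    bound (inj₂ |A|≡0) = subst (_< 1 + m) (sym |A|≡0) (s≤s z≤n)
  facet : ∀ b → Connected (slice b A)
  facet false = cube-connected m _ (inj₁ (slice-short false A |A|≤m (n≢0⇒n>0 nonempty₁)))
  facet true = cube-connected m _ (inj₁ (slice-short true A |A|≤m (n≢0⇒n>0 nonempty₀)))
  free : Σ (CubeVertex m) λ v → ∀ b → v ∉ slice b A
  free = common-free-vertex A (≤-<-trans (≤-pred |A|≤m) (n<2^n m))

free-vertices-connected : ∀ m → 2 ≤ m → (A : List (CubeVertex (suc m))) → length A ≤ suc m →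
  ∀ {u w} → u ∉ A → FreeNeighbour A u → w ∉ A → FreeNeighbour A w → Walk A u w
free-vertices-connected m 2≤m A |A| u∉ free-u w∉ free-w
  with length (slice false A) ≤? 1 | length (slice true A) ≤? 1
... | yes sparse | _ = connect-via-facet A false (cube-connected m _ (inj₁ (≤-trans (s≤s sparse) 2≤m)))
                         (enter-sparse-facet A false sparse u∉ free-u) (enter-sparse-facet A false sparse w∉ free-w)
... | no _ | yes sparse = connect-via-facet A true (cube-connected m _ (inj₁ (≤-trans (s≤s sparse) 2≤m)))
                            (enter-sparse-facet A true sparse u∉ free-u) (enter-sparse-facet A true sparse w∉ free-w)
... | no dense₀ | no dense₁ = connect-via-bridge A facet (proj₂ free) u∉ w∉
  where
  facet : ∀ b → Connected (slice b A)
  facet false = cube-connected m _ (inj₁ (slice-short false A (s≤s |A|) (≰⇒> dense₁)))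
  facet true = cube-connected m _ (inj₁ (slice-short true A (s≤s |A|) (≰⇒> dense₀)))
  free : Σ (CubeVertex m) λ v → ∀ b → v ∉ slice b A
  free = common-free-vertex A (≤-<-trans |A| (1+n<2^n 2≤m))

-- From walks to X-valid paths

last-of : ∀ {n} → CubeVertex n → List (CubeVertex n) → CubeVertex n
last-of u [] = u
last-of u (x ∷ xs) = last-of x xs

last-of-∷ʳ : ∀ {n} (u : CubeVertex n) xs x → last-of u (xs ∷ʳ x) ≡ x
last-of-∷ʳ u [] x = refl
last-of-∷ʳ u (y ∷ xs) x = last-of-∷ʳ y xs x

record Path {n} (A : List (CubeVertex n)) (u w : CubeVertex n) : Set where
  constructor path
  field
    rest : List (CubeVertex n)
    linked : Linked CubeAdj (u ∷ rest)
    distinct : Unique (u ∷ rest)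
    avoiding : All (_∉ A) (u ∷ rest)
    ends : last-of u rest ≡ w

cut : ∀ {n} {A : List (CubeVertex n)} {u x} (xs : List (CubeVertex n)) → u ∈ x ∷ xs →
  Linked CubeAdj (x ∷ xs) → Unique (x ∷ xs) → All (_∉ A) (x ∷ xs) → Path A u (last-of x xs)
cut xs (here refl) linked distinct avoiding = path xs linked distinct avoiding refl
cut (_ ∷ xs) (there u∈) (_ ∷ linked) (_ ∷ distinct) (_ ∷ avoiding) = cut xs u∈ linked distinct avoiding

-- Every walk contains a path between its endpoints: cut out each loop.
walk⇒path : ∀ {n} {A : List (CubeVertex n)} {u w} → Walk A u w → Path A u w
walk⇒path (stay u∉) = path [] [-] ([] ∷ []) (u∉ ∷ []) refl
walk⇒path {u = u} (step {v = v} u∉ adj walk) with walk⇒path walk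
... | path xs linked distinct avoiding refl with u ∈ᵥ? (v ∷ xs)
...   | yes u∈ = cut xs u∈ linked distinct avoiding
...   | no u∉vxs = path (v ∷ xs) (adj ∷ linked) (All.¬Any⇒All¬ (v ∷ xs) u∉vxs ∷ distinct) (u∉ ∷ avoiding) refl

-- A path from s ≠ t avoiding A is X-valid when X contains nothing outside A
-- except s and t: its inner vertices differ from s and t and avoid A.
path⇒valid : ∀ {n} (X A : List (CubeVertex n)) {s t} → s ≢ t →
  (∀ {y} → y ∈ X → y ∉ A → y ≡ s ⊎ y ≡ t) → Path A s t → XValidPath X s t
path⇒valid X A {s} {t} s≢t covered (path rest linked distinct avoiding ends) with initLast rest
... | [] = ⊥-elim (s≢t ends)
... | inner ∷ʳ′ x with refl ← trans (sym (last-of-∷ʳ s inner x)) ends =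
  inner , linked , distinct , inner-outside distinct avoiding
  where
  outside : ∀ {y} → (s ≢ y × y ≢ t) × y ∉ A → y ∉ X
  outside ((s≢y , y≢t) , y∉A) y∈X with covered y∈X y∉A
  ... | inj₁ y≡s = s≢y (sym y≡s)
  ... | inj₂ y≡t = y≢t y≡t
  inner-outside : Unique (s ∷ inner ∷ʳ t) → All (_∉ A) (s ∷ inner ∷ʳ t) → All (_∉ X) inner
  inner-outside (s≢ ∷ distinct′) (_ ∷ avoiding′) =
    All.zipWith outside (All.zip (All.++⁻ˡ inner s≢ , AllPairs-∷ʳ⁻ inner distinct′) , All.++⁻ˡ inner avoiding′)

-- Isolated vertices

Isolated : ∀ {n} → List (CubeVertex n) → CubeVertex n → Set
Isolated X a = ∀ {y} → CubeAdj a y → y ∈ X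

free? : ∀ {n} (X : List (CubeVertex n)) a → Dec (FreeNeighbour X a)
free? X a with Fin.any? (λ i → ¬? (flipAt i a ∈ᵥ? X))
... | yes (i , flip∉) = yes (flipAt i a , adj-flip i a , flip∉)
... | no none = no λ (y , adj , y∉) → let (i , y≡) = adj⇒flip a y adj in none (i , subst (_∉ X) y≡ y∉)

¬free⇒isolated : ∀ {n} {X : List (CubeVertex n)} a → ¬ FreeNeighbour X a → Isolated X a
¬free⇒isolated {X = X} a no-free {y} adj = decidable-stable (y ∈ᵥ? X) (λ y∉ → no-free (y , adj , y∉))

free-⊆ : ∀ {n} {A X : List (CubeVertex n)} u → (∀ {y} → y ∈ A → y ∈ X) → FreeNeighbour X u → FreeNeighbour A u
free-⊆ u A⊆X (y , adj , y∉X) = y , adj , y∉X ∘ A⊆X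

GoodPair : ∀ {n} → List (CubeVertex n) → CubeVertex n → CubeVertex n → Set
GoodPair X s t = FreeNeighbour X s × FreeNeighbour X t

good-pair? : ∀ {n} (X : List (CubeVertex n)) s t → Dec (GoodPair X s t)
good-pair? X s t = free? X s ×-dec free? X t

bad-pair⇒isolated : ∀ {n} (X : List (CubeVertex n)) {s t} → ¬ GoodPair X s t →
  Σ (CubeVertex n) λ v → (v ≡ s ⊎ v ≡ t) × Isolated X v
bad-pair⇒isolated X {s} {t} bad with free? X s | free? X t
... | no ¬free-s | _ = s , inj₁ refl , ¬free⇒isolated s ¬free-s
... | yes _ | no ¬free-t = t , inj₂ refl , ¬free⇒isolated t ¬free-t
... | yes free-s | yes free-t = ⊥-elim (bad (free-s , free-t))

neighbours : ∀ {n} → CubeVertex n → List (CubeVertex n)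
neighbours a = tabulate (λ i → flipAt i a)

flip-≢ : ∀ {n} (i : Fin n) (a : CubeVertex n) → a ≢ flipAt i a
flip-≢ i a a≡ = adj-irrefl a (subst (CubeAdj a) (sym a≡) (adj-flip i a))

far-≢ : ∀ {n} {a c : CubeVertex n} → 2 ≤ hamming a c → a ≢ c
far-≢ {a = a} far refl with () ← ≤-trans far (≤-reflexive (hamming-self a))

far-∉-neighbours : ∀ {n} {a c : CubeVertex n} → 2 ≤ hamming a c → c ∉ neighbours a
far-∉-neighbours {a = a} far c∈ with ∈-tabulate⁻ c∈
... | i , refl with s≤s () ← ≤-trans far (≤-reflexive (adj-flip i a))

TwoFar : ∀ {n} → List (CubeVertex n) → CubeVertex n → Set
TwoFar {n} X a = Σ (CubeVertex n) λ c₁ → Σ (CubeVertex n) λ c₂ →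
  c₁ ∈ X × c₂ ∈ X × c₁ ≢ c₂ × 2 ≤ hamming a c₁ × 2 ≤ hamming a c₂

-- An isolated vertex a, its n neighbours and two far vertices are n + 3
-- distinct members of X.
isolated-bound : ∀ {n} (X : List (CubeVertex n)) {a} → a ∈ X → Isolated X a → TwoFar X a → 3 + n ≤ length X
isolated-bound {n} X {a} a∈ iso (c₁ , c₂ , c₁∈ , c₂∈ , c₁≢c₂ , far₁ , far₂) = begin
  3 + n     ≡⟨ cong suc (trans (+-comm 2 n) (sym |L|)) ⟩
  length L  ≤⟨ unique-⊆-length L X distinct L⊆X ⟩
  length X  ∎
  where
  open ≤-Reasoning
  far : List (CubeVertex n)
  far = c₁ ∷ c₂ ∷ []
  L : List (CubeVertex n)
  L = a ∷ neighbours a ++ far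
  |L| : length (neighbours a ++ far) ≡ n + 2
  |L| = trans (length-++ (neighbours a)) (cong (_+ 2) (length-tabulate (λ i → flipAt i a)))
  disjoint : ∀ {v} → ¬ (v ∈ neighbours a × v ∈ far)
  disjoint (v∈ , here refl) = far-∉-neighbours far₁ v∈
  disjoint (v∈ , there (here refl)) = far-∉-neighbours far₂ v∈
  L⊆X : All (_∈ X) L
  L⊆X = a∈ ∷ All.++⁺ (All.tabulate⁺ (λ i → iso (adj-flip i a))) (c₁∈ ∷ c₂∈ ∷ [])
  distinct : Unique L
  distinct = All.++⁺ (All.tabulate⁺ (λ i → flip-≢ i a)) (far-≢ far₁ ∷ far-≢ far₂ ∷ [])
           ∷ Unique.++⁺ (Unique.tabulate⁺ (flip-injective _ _ a)) ((c₁≢c₂ ∷ []) ∷ [] ∷ []) disjoint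

two-other-directions : ∀ {m} → 2 ≤ m → (j : Fin (suc m)) →
  Σ (Fin (suc m)) λ i₁ → Σ (Fin (suc m)) λ i₂ → i₁ ≢ j × i₂ ≢ j × i₁ ≢ i₂
two-other-directions (s≤s (s≤s _)) zero = suc zero , suc (suc zero) , (λ ()) , (λ ()) , (λ ())
two-other-directions (s≤s (s≤s _)) (suc zero) = zero , suc (suc zero) , (λ ()) , (λ ()) , (λ ())
two-other-directions (s≤s (s≤s _)) (suc (suc j)) = zero , suc zero , (λ ()) , (λ ()) , (λ ())

-- Any isolated vertex b ≠ a of X supplies two members of X far from a: if b
-- is a neighbour of a, two neighbours of b off the edge ab; otherwise b itself
-- and a neighbour of b moving away from (or staying far from) a.
isolated⇒two-far : ∀ {m} → 2 ≤ m → (X : List (CubeVertex (suc m))) {a b : CubeVertex (suc m)} →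
  a ≢ b → b ∈ X → Isolated X b → TwoFar X a
isolated⇒two-far 2≤m X {a} {b} a≢b b∈ iso-b with hamming a b in dist
... | zero = ⊥-elim (a≢b (hamming≡0⇒≡ a b dist))
... | suc zero with adj⇒flip a b dist
...   | j , refl with two-other-directions 2≤m j
...     | i₁ , i₂ , i₁≢j , i₂≢j , i₁≢i₂ =
  flipAt i₁ b , flipAt i₂ b , iso-b (adj-flip i₁ b) , iso-b (adj-flip i₂ b) , i₁≢i₂ ∘ flip-injective i₁ i₂ b ,
  ≤-reflexive (sym (hamming-flip-flip i₁ j a i₁≢j)) , ≤-reflexive (sym (hamming-flip-flip i₂ j a i₂≢j))
isolated⇒two-far 2≤m X {a} {b} a≢b b∈ iso-b | suc (suc _) =
  let far-b = ≤-trans (s≤s (s≤s z≤n)) (≤-reflexive (sym dist))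
      (i , far-i) = far-flip 2≤m a b far-b
  in b , flipAt i b , b∈ , iso-b (adj-flip i b) , flip-≢ i b , far-b , far-i

at-most-one-isolated : ∀ {n} → 3 ≤ n → (X : List (CubeVertex n)) → length X ≡ suc (suc n) →
  ∀ {a b} → a ∈ X → b ∈ X → Isolated X a → Isolated X b → a ≡ b
at-most-one-isolated {suc m} (s≤s 2≤m) X |X| {a} {b} a∈ b∈ iso-a iso-b with a ≟ᵥ b
... | yes a≡b = a≡b
... | no a≢b = ⊥-elim (<-irrefl refl too-many)
  where
  too-many : 3 + suc m ≤ 2 + suc m
  too-many = ≤-trans (isolated-bound X a∈ iso-a (isolated⇒two-far 2≤m X a≢b b∈ iso-b)) (≤-reflexive |X|)

-- For n ≥ 3 and |X| = n + 2, two distinct s, t ∈ X that both have a neighbour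
-- outside X are joined by an X-valid path: delete s and t from X and connect
-- them around the remaining ≤ n vertices.
pair-path : ∀ {n} → 3 ≤ n → (X : List (CubeVertex n)) → length X ≡ suc (suc n) →
  ∀ {s t} → s ≢ t → s ∈ X → t ∈ X → FreeNeighbour X s → FreeNeighbour X t → XValidPath X s t
pair-path {suc m} (s≤s 2≤m) X |X| {s} {t} s≢t s∈ t∈ free-s free-t =
  path⇒valid X A s≢t covered
    (walk⇒path (free-vertices-connected m 2≤m A |A| s∉A (free-⊆ s A⊆X free-s) t∉A (free-⊆ t A⊆X free-t)))
  where
  A : List (CubeVertex (suc m))
  A = remove t (remove s X)
  A⊆X : ∀ {y} → y ∈ A → y ∈ X
  A⊆X y∈ = proj₁ (∈-remove⁻ X (proj₁ (∈-remove⁻ (remove s X) y∈)))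
  s∉A : s ∉ A
  s∉A s∈A = proj₂ (∈-remove⁻ X (proj₁ (∈-remove⁻ (remove s X) s∈A))) refl
  t∉A : t ∉ A
  t∉A t∈A = proj₂ (∈-remove⁻ (remove s X) t∈A) refl
  |A| : length A ≤ suc m
  |A| = ≤-pred (≤-pred (≤-trans (s≤s (remove-shorter (remove s X) (∈-remove⁺ X t∈ (s≢t ∘ sym))))
                                (≤-trans (remove-shorter X s∈) (≤-reflexive |X|))))
  covered : ∀ {y} → y ∈ X → y ∉ A → y ≡ s ⊎ y ≡ t
  covered {y} y∈ y∉ with y ≟ᵥ s | y ≟ᵥ t
  ... | yes y≡s | _ = inj₁ y≡s
  ... | no _ | yes y≡t = inj₂ y≡t
  ... | no y≢s | no y≢t = ⊥-elim (y∉ (∈-remove⁺ (remove s X) (∈-remove⁺ X y∈ y≢s) y≢t))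

-- A decidable property of Fin K failing for at most one index holds on a
-- subset of size at least K ∸ 1: everything but the failing index, if any.
all-but-one : ∀ {K} {P : Fin K → Set} → (∀ i → Dec (P i)) → (∀ {i j} → ¬ P i → ¬ P j → i ≡ j) →
  Σ (Subset K) λ S → K ∸ 1 ≤ ∣ S ∣ × (∀ i → i ∈ₛ S → P i)
all-but-one {K} P? one-bad with Fin.any? (λ i → ¬? (P? i))
... | no none = ⊤ , ≤-trans (m∸n≤m K 1) (≤-reflexive (sym (∣⊤∣≡n K))) ,
                λ i _ → decidable-stable (P? i) (λ ¬Pi → none (i , ¬Pi))
... | yes (j , ¬Pj) = ∁ ⁅ j ⁆ , ≤-reflexive (sym (trans (∣∁p∣≡n∸∣p∣ ⁅ j ⁆) (cong (K ∸_) (∣⁅x⁆∣≡1 j)))) ,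
                      λ i i∈ → decidable-stable (P? i) (λ ¬Pi →
                        x∈∁p⇒x∉p i∈ (subst (_∈ₛ ⁅ j ⁆) (sym (one-bad ¬Pi ¬Pj)) (x∈⁅x⁆ j)))

module Pairing {A : Set} {K} (s t : Fin K → A) (distinct : Unique (map s (allFin K) ++ map t (allFin K)))
               {X : List A} (ends∈X : All (_∈ X) (map s (allFin K) ++ map t (allFin K))) where

  End : Fin K → A → Set
  End i v = v ≡ s i ⊎ v ≡ t i

  end∈X : ∀ {i v} → End i v → v ∈ X
  end∈X {i} (inj₁ refl) = All.lookup ends∈X (∈-++⁺ˡ (∈-map⁺ s (∈-allFin i)))
  end∈X {i} (inj₂ refl) = All.lookup ends∈X (∈-++⁺ʳ _ (∈-map⁺ t (∈-allFin i)))

  s≢t : ∀ i j → s i ≢ t j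
  s≢t i j = unique-++-disjoint (map s (allFin K)) _ distinct (∈-map⁺ s (∈-allFin i)) (∈-map⁺ t (∈-allFin j))

  private
    injective : ∀ (f : Fin K → A) → Unique (map f (allFin K)) → ∀ {i j} → i ≢ j → f i ≢ f j
    injective f = unique-tabulate⁻ f ∘ subst Unique (map-tabulate (λ i → i) f)

  different-pairs : ∀ {i j v w} → i ≢ j → End i v → End j w → v ≢ w
  different-pairs i≢j (inj₁ refl) (inj₁ refl) = injective s (unique-++⁻ˡ _ _ distinct) i≢j
  different-pairs {i} {j} _ (inj₁ refl) (inj₂ refl) = s≢t i j
  different-pairs {i} {j} _ (inj₂ refl) (inj₁ refl) = s≢t j i ∘ sym
  different-pairs i≢j (inj₂ refl) (inj₂ refl) = injective t (unique-++⁻ʳ (map s (allFin K)) _ distinct) i≢j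

-- At most one pair has an isolated endpoint (by at-most-one-isolated); all
-- other pairs are joined by pair-path.
lemma21 : (n : ℕ) → 4 ≤ suc n →
    (X : List (CubeVertex n)) → Unique X → length X ≡ suc (suc n) →
    (s t : Fin (suc (suc n) / 2) → CubeVertex n) →
    Unique (map s (allFin (suc (suc n) / 2)) ++ map t (allFin (suc (suc n) / 2))) →
    All (_∈ X) (map s (allFin (suc (suc n) / 2)) ++ map t (allFin (suc (suc n) / 2))) →
    Σ (Subset (suc (suc n) / 2)) λ S →
    ((suc (suc n) / 2) ∸ 1 ≤ ∣ S ∣) ×
    (∀ i → i ∈ₛ S → XValidPath X (s i) (t i))
lemma21 n (s≤s 3≤n) X _ |X| s t distinct ends∈X =
  let (S , size , good) = all-but-one (λ i → good-pair? X (s i) (t i)) at-most-one-bad in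
  S , size , λ i i∈S → let (free-s , free-t) = good i i∈S in
    pair-path 3≤n X |X| (s≢t i i) (end∈X (inj₁ refl)) (end∈X (inj₂ refl)) free-s free-t
  where
  open Pairing s t distinct ends∈X
  at-most-one-bad : ∀ {i j} → ¬ GoodPair X (s i) (t i) → ¬ GoodPair X (s j) (t j) → i ≡ j
  at-most-one-bad {i} {j} bad-i bad-j with i Fin.≟ j | bad-pair⇒isolated X bad-i | bad-pair⇒isolated X bad-j
  ... | yes i≡j | _ | _ = i≡j
  ... | no i≢j | v , end-v , iso-v | w , end-w , iso-w = ⊥-elim (different-pairs i≢j end-v end-w
         (at-most-one-isolated 3≤n X |X| (end∈X end-v) (end∈X end-w) iso-v iso-w))
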